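{- Let $\phi$ be a cyclic formula with root $r$, and let $G$ be its set of $\Box$-occurrences. Assign to each $a\in G$ a variable $q_a$, pairwise distinct and not occurring in $\phi$, and let $\psi_a:={\sf E}_\phi(a)$. Then $\bigwedge_{a\in G}\boxdot^\bullet(q_a\leftrightarrow\Box\psi_{S_0a})\vdash_{\mathsf{CHL}}\psi_r\leftrightarrow\phi$.
   Context: Labels: $\bot,\top$ and propositional variables (arity 0), $\neg,\Box$ (arity 1), $\wedge,\vee,\to$ (arity 2). A graph is $\langle V,r,S,\lambda\rangle$ with $V$ finite, root $r$, labelling $\lambda$, $S:V\to V^{*}$ ordered successors (length = arity of label), $S_i(a)$ the $i$-th; every vertex reachable from $r$. A (cyclic) formula is a graph in which every cycle (closed path of pairwise distinct vertices along successors) contains a $\Box$-labelled vertex ($\Box$-occurrence). Bisimulation: $aRa'$ implies equal labels and $i$-th successors related; $\simeq$ = bisimilarity relating roots. $\digamma p.\chi$ (for $\chi$ modalised in $p$, i.e. every root-to-$p$ path passes a $\Box$-occurrence) identifies the root with all $p$-labelled vertices, keeping the root's label. ${\sf E}_\phi$ maps vertices of $\phi$ to acyclic (ordinary) modal formulas by recursion along successors with $\Box$-occurrences as base: ${\sf E}_\phi(a):=q_a$ if $a$ is a $\Box$-occurrence; ${\sf E}_\phi(a):=\$( {\sf E}_\phi(S_0a),\dots,{\sf E}_\phi(S_{n-1}a))$ if $a$ has any other label $\$$ of arity $n$ (a $p$-occurrence gives $p$). $\mathsf{CHL}$: least set of cyclic formulas containing all substitution instances of propositional tautologies, all $\Box(\phi\to\psi)\to(\Box\phi\to\Box\psi)$,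 all $\phi\leftrightarrow\psi$ with $\phi\simeq\psi$, closed under modus ponens, necessitation and Löb's rule (from $\vdash\Box\phi\to\phi$ infer $\vdash\phi$). $\Gamma\vdash_{\mathsf{CHL}}\phi$ means $\mathsf{CHL}\vdash\bigwedge\Gamma\to\phi$. $\Box^\bullet\chi:=\digamma p.\Box(\chi\wedge p)$ ($p$ not in $\chi$); $\boxdot^\bullet\chi:=\chi\wedge\Box^\bullet\chi$. -}

module Defs where

open import Data.Nat using (ℕ; zero; suc; _+_)
open import Data.Bool using (Bool; true; false; not; _∧_; _∨_)
open import Data.Fin using (Fin; zero; suc; splitAt; _↑ˡ_; _↑ʳ_)
open import Data.Sum using (_⊎_; inj₁; inj₂)
open import Data.Product using (Σ; _×_; _,_)
open import Data.Vec using (Vec; []; _∷_)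
import Data.Vec as Vec
open import Data.Vec.Membership.Propositional renaming (_∈_ to _∈ᵥ_)
open import Data.Vec.Relation.Binary.Pointwise.Inductive using (Pointwise)
open import Data.List using (List; []; _∷_; _++_; [_]; allFin; concatMap; foldr; map)
open import Data.List.Relation.Unary.Any using (Any)
open import Data.List.Relation.Unary.Unique.Propositional using (Unique)
open import Data.List.Relation.Unary.Linked using (Linked)
open import Relation.Binary.PropositionalEquality using (_≡_)

data Label : Set where
  bot top : Label
  var     : ℕ → Label
  neg box : Label
  and or imp : Label

arity : Label → ℕ
arity bot = 0
arity top = 0
arity (var _) = 0
arity neg = 1
arity box = 1
arity and = 2
arity or  = 2
arity imp = 2

record Graph : Set where
  field
    size : ℕ
    root : Fin size
    lab  : Fin size → Label
    succ : (a : Fin size) → Vec (Fin size) (arity (lab a))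
open Graph public

module _ (G : Graph) where
  Edge : Fin (size G) → Fin (size G) → Set
  Edge a b = b ∈ᵥ succ G a

  data Reach : Fin (size G) → Set where
    reach-root : Reach (root G)
    reach-step : ∀ {a b} → Reach a → Edge a b → Reach b

  IsBoxV : Fin (size G) → Set
  IsBoxV a = lab G a ≡ box

  IsCycle : List (Fin (size G)) → Set
  IsCycle [] = Data.Empty.⊥ where import Data.Empty
  IsCycle (v ∷ vs) = Unique (v ∷ vs) × Linked Edge ((v ∷ vs) ++ [ v ])

  IsFormula : Set
  IsFormula = (∀ a → Reach a) × (∀ xs → IsCycle xs → Any IsBoxV xs)

IsBisim : (G H : Graph) → (Fin (size G) → Fin (size H) → Set) → Set
IsBisim G H R = ∀ a a' → R a a' →
  (lab G a ≡ lab H a') × Pointwise R (succ G a) (succ H a')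

_≃_ : Graph → Graph → Set₁
G ≃ H = Σ (Fin (size G) → Fin (size H) → Set) λ R → IsBisim G H R × R (root G) (root H)

leafG : (l : Label) → arity l ≡ 0 → Graph
leafG l e = record { size = 1 ; root = zero ; lab = λ _ → l ; succ = s }
  where
  s : Fin 1 → Vec (Fin 1) (arity l)
  s zero rewrite e = []

⊥G ⊤G : Graph
⊥G = leafG bot Relation.Binary.PropositionalEquality.refl
⊤G = leafG top Relation.Binary.PropositionalEquality.refl

varG : ℕ → Graph
varG p = leafG (var p) Relation.Binary.PropositionalEquality.refl

data U : Set where uneg ubox : U

ulab : U → Label
ulab uneg = neg
ulab ubox = box

vec1 : ∀ {n} (u : U) → Fin n → Vec (Fin n) (arity (ulab u))
vec1 uneg x = x ∷ []
vec1 ubox x = x ∷ []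

unG : U → Graph → Graph
unG u G = record { size = suc (size G) ; root = zero ; lab = l ; succ = s }
  where
  l : Fin (suc (size G)) → Label
  l zero = ulab u
  l (suc a) = lab G a
  s : (a : Fin (suc (size G))) → Vec (Fin (suc (size G))) (arity (l a))
  s zero = vec1 u (suc (root G))
  s (suc a) = Vec.map suc (succ G a)

¬G □G : Graph → Graph
¬G = unG uneg
□G = unG ubox

data B : Set where band bor bimp : B

blab : B → Label
blab band = and
blab bor  = or
blab bimp = imp

vec2 : ∀ {n} (b : B) → Fin n → Fin n → Vec (Fin n) (arity (blab b))
vec2 band x y = x ∷ y ∷ []
vec2 bor  x y = x ∷ y ∷ []
vec2 bimp x y = x ∷ y ∷ []

binG : B → Graph → Graph → Graph
binG b G H = record { size = suc (m + k) ; root = zero ; lab = l ; succ = s }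
  where
  m = size G
  k = size H
  inl : Fin m → Fin (suc (m + k))
  inl a = suc (a ↑ˡ k)
  inr : Fin k → Fin (suc (m + k))
  inr a = suc (m ↑ʳ a)
  lS : Fin m ⊎ Fin k → Label
  lS (inj₁ a) = lab G a
  lS (inj₂ a) = lab H a
  sS : (x : Fin m ⊎ Fin k) → Vec (Fin (suc (m + k))) (arity (lS x))
  sS (inj₁ a) = Vec.map inl (succ G a)
  sS (inj₂ a) = Vec.map inr (succ H a)
  l : Fin (suc (m + k)) → Label
  l zero = blab b
  l (suc i) = lS (splitAt m i)
  s : (a : Fin (suc (m + k))) → Vec (Fin (suc (m + k))) (arity (l a))
  s zero = vec2 b (inl (root G)) (inr (root H))
  s (suc i) = sS (splitAt m i)

_∧G_ _∨G_ _⇒G_ _⇔G_ : Graph → Graph → Graph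
_∧G_ = binG band
_∨G_ = binG bor
_⇒G_ = binG bimp
φ ⇔G ψ = (φ ⇒G ψ) ∧G (ψ ⇒G φ)

-- □^• χ := ϝp.□(χ ∧ p)  (p fresh), written out: the root (□) points to an
-- ∧-vertex whose successors are the root of χ and the root itself.
□•G : Graph → Graph
□•G G = record { size = suc (suc (size G)) ; root = zero ; lab = l ; succ = s }
  where
  l : Fin (suc (suc (size G))) → Label
  l zero = box
  l (suc zero) = and
  l (suc (suc a)) = lab G a
  s : (a : Fin (suc (suc (size G)))) → Vec (Fin (suc (suc (size G)))) (arity (l a))
  s zero = suc zero ∷ []
  s (suc zero) = suc (suc (root G)) ∷ zero ∷ []
  s (suc (suc a)) = Vec.map (λ x → suc (suc x)) (succ G a)

⊡•G : Graph → Graph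
⊡•G χ = χ ∧G □•G χ

⋀G : List Graph → Graph
⋀G = foldr _∧G_ ⊤G

data Fm : Set where
  ⊥ᶠ ⊤ᶠ : Fm
  varᶠ  : ℕ → Fm
  ¬ᶠ □ᶠ : Fm → Fm
  _∧ᶠ_ _∨ᶠ_ _⇒ᶠ_ : Fm → Fm → Fm

treeG : Fm → Graph
treeG ⊥ᶠ = ⊥G
treeG ⊤ᶠ = ⊤G
treeG (varᶠ p) = varG p
treeG (¬ᶠ A) = ¬G (treeG A)
treeG (□ᶠ A) = □G (treeG A)
treeG (A ∧ᶠ B) = treeG A ∧G treeG B
treeG (A ∨ᶠ B) = treeG A ∨G treeG B
treeG (A ⇒ᶠ B) = treeG A ⇒G treeG B

data PF : Set where
  ⊥ᵖ ⊤ᵖ : PF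
  atom  : ℕ → PF
  ¬ᵖ    : PF → PF
  _∧ᵖ_ _∨ᵖ_ _⇒ᵖ_ : PF → PF → PF

evalP : (ℕ → Bool) → PF → Bool
evalP v ⊥ᵖ = false
evalP v ⊤ᵖ = true
evalP v (atom p) = v p
evalP v (¬ᵖ A) = not (evalP v A)
evalP v (A ∧ᵖ B) = evalP v A ∧ evalP v B
evalP v (A ∨ᵖ B) = evalP v A ∨ evalP v B
evalP v (A ⇒ᵖ B) = not (evalP v A) ∨ evalP v B

Tautology : PF → Set
Tautology A = ∀ v → evalP v A ≡ true

substG : PF → (ℕ → Graph) → Graph
substG ⊥ᵖ σ = ⊥G
substG ⊤ᵖ σ = ⊤G
substG (atom p) σ = σ p
substG (¬ᵖ A) σ = ¬G (substG A σ)
substG (A ∧ᵖ B) σ = substG A σ ∧G substG B σ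
substG (A ∨ᵖ B) σ = substG A σ ∨G substG B σ
substG (A ⇒ᵖ B) σ = substG A σ ⇒G substG B σ

data ⊢CHL_ : Graph → Set₁ where
  taut : (A : PF) → Tautology A → (σ : ℕ → Graph) → (∀ p → IsFormula (σ p)) →
         ⊢CHL substG A σ
  axK  : (φ ψ : Graph) → IsFormula φ → IsFormula ψ →
         ⊢CHL (□G (φ ⇒G ψ) ⇒G (□G φ ⇒G □G ψ))
  bisim : (φ ψ : Graph) → IsFormula φ → IsFormula ψ → φ ≃ ψ → ⊢CHL (φ ⇔G ψ)
  mp   : {φ ψ : Graph} → ⊢CHL φ → ⊢CHL (φ ⇒G ψ) → ⊢CHL ψ
  nec  : {φ : Graph} → ⊢CHL φ → ⊢CHL (□G φ)
  löb  : {φ : Graph} → ⊢CHL (□G φ ⇒G φ) → ⊢CHL φ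

_⊢CHL_ : List Graph → Graph → Set₁
Γ ⊢CHL φ = ⊢CHL (⋀G Γ ⇒G φ)

-- Implemented with fuel; for a cyclic formula fuel (suc size) is more than
-- enough, since every □-free path visits pairwise distinct vertices.

module _ (G : Graph) (q : Fin (size G) → ℕ) where
  Efuel : ℕ → Fin (size G) → Fm
  Efuel zero a = ⊥ᶠ
  Efuel (suc f) a = go (lab G a) (succ G a)
    where
    go : (l : Label) → Vec (Fin (size G)) (arity l) → Fm
    go bot [] = ⊥ᶠ
    go top [] = ⊤ᶠ
    go (var p) [] = varᶠ p
    go neg (b ∷ []) = ¬ᶠ (Efuel f b)
    go box (b ∷ []) = varᶠ (q a)
    go and (b ∷ c ∷ []) = Efuel f b ∧ᶠ Efuel f c
    go or  (b ∷ c ∷ []) = Efuel f b ∨ᶠ Efuel f c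
    go imp (b ∷ c ∷ []) = Efuel f b ⇒ᶠ Efuel f c

  E : Fin (size G) → Fm
  E = Efuel (suc (size G))

  hypAt : (a : Fin (size G)) → (l : Label) → Vec (Fin (size G)) (arity l) → List Graph
  hypAt a box (c ∷ []) = [ ⊡•G (varG (q a) ⇔G □G (treeG (E c))) ]
  hypAt a _ _ = []

  Hyps : List Graph
  Hyps = concatMap (λ a → hypAt a (lab G a) (succ G a)) (allFin (size G))

-- For a vertex b of φ let φ_b be the formula generated at b, and let Θ be the conjunction of the
-- hypotheses and Ω := ⋀_b (ψ_b ↔ φ_b).  Assuming Θ ∧ □Ω, every ψ_b ↔ φ_b follows by induction on
-- the distance from b to the next □-occurrence: a connective other than □ commutes with ↔ and
-- φ_b is bisimilar to that connective applied to the φ of its successors, while at a □-occurrence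
-- the hypothesis and □Ω give q_b ↔ □ψ_{S₀b} ↔ □φ_{S₀b} ≃ φ_b.  Each ⊡^•χ implies its own box,
-- because □^•χ ≃ □⊡^•χ, so Θ → □Θ and hence □(Θ → Ω) → (Θ → Ω); Löb's rule yields Θ → Ω,
-- and at the root φ_r ≃ φ.

module Submission where

open import Defs
open import Data.Bool using (Bool; true; false; T; not; _∧_; _∨_)
open import Data.Bool.Properties using (T-≡)
open import Data.Empty using (⊥; ⊥-elim)
open import Data.Fin using (Fin; zero; suc; toℕ; splitAt; _↑ˡ_; _↑ʳ_)
import Data.Fin.Properties as Finₚ
open import Data.Fin.Subset using (Subset; _∈_; _∉_; ⁅_⁆; _∪_; ∣_∣; _⊂_)
open import Data.Fin.Subset.Properties using (_∈?_)
import Data.Fin.Subset.Properties as Subsetₚ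
open import Data.List
  using (List; []; _∷_; _++_; [_]; length; lookup; map; foldr; filter; allFin; concatMap)
import Data.List.Properties as Listₚ
open import Data.List.Membership.Propositional using () renaming (_∈_ to _∈ₗ_; lose to loseₗ)
import Data.List.Membership.Propositional.Properties as ∈ₗₚ
open import Data.List.Relation.Unary.All using (All; []; _∷_)
import Data.List.Relation.Unary.All as All
import Data.List.Relation.Unary.All.Properties as Allₚ
open import Data.List.Relation.Unary.AllPairs using ([]; _∷_)
open import Data.List.Relation.Unary.Any using (Any)
import Data.List.Relation.Unary.Any as Any
import Data.List.Relation.Unary.Any.Properties as Anyₚ
open import Data.List.Relation.Unary.Linked using (Linked; []; [-]; _∷_) renaming (tail to Linked-tail)
open import Data.List.Relation.Unary.Unique.Propositional using (Unique)
import Data.List.Relation.Unary.Unique.Propositional.Properties as Uniqueₚ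
open import Data.Nat using (ℕ; zero; suc; _+_; _≤_; _<_; _⊔_; _<ᵇ_; s≤s)
import Data.Nat.Properties as ℕₚ
open import Data.Product using (∃; ∃₂; ∃-syntax; _×_; _,_; proj₁; proj₂)
open import Data.Sum using (_⊎_; inj₁; inj₂)
open import Data.Unit using (⊤)
open import Data.Vec using (Vec; []; _∷_)
import Data.Vec as Vec
import Data.Vec.Functional as VF
import Data.Vec.Functional.Properties as VFₚ
open import Data.Vec.Membership.Propositional using (find; lose) renaming (_∈_ to _∈ᵥ_)
import Data.Vec.Membership.Propositional.Properties as Vecₚ
open import Data.Vec.Relation.Binary.Pointwise.Inductive using (Pointwise; []; _∷_)
import Data.Vec.Relation.Binary.Pointwise.Inductive as Pw
open import Data.Vec.Relation.Unary.All using ([]; _∷_) renaming (All to VAll)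
import Data.Vec.Relation.Unary.All as VAll
open import Data.Vec.Relation.Unary.Any using (here; there)
import Data.Vec.Relation.Unary.Any as VAny
open import Function using (_∘_; id)
open import Function.Bundles using (Equivalence)
open import Relation.Binary.Definitions using (DecidableEquality)
open import Relation.Binary.PropositionalEquality hiding ([_])
open import Relation.Nullary using (¬_; Dec; yes; no)
open import Relation.Nullary.Decidable using (toSum; _×-dec_; ¬?)

Linked-snoc : ∀ {A : Set} {R : A → A → Set} {v y} x xs →
  Linked R (x ∷ xs ++ [ v ]) → R v y → Linked R ((x ∷ xs ++ [ v ]) ++ [ y ])
Linked-snoc x [] (r ∷ [-]) r′ = r ∷ r′ ∷ [-]
Linked-snoc x (z ∷ zs) (r ∷ rs) r′ = r ∷ Linked-snoc z zs rs r′

module _ {A : Set} where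

  Segment : List A → List A → Set
  Segment ys xs = ∃₂ λ pre post → xs ≡ pre ++ ys ++ post

  Segment-∷ : ∀ {ys xs} x → Segment ys xs → Segment ys (x ∷ xs)
  Segment-∷ x (pre , post , refl) = x ∷ pre , post , refl

  All-segment : ∀ {P : A → Set} {ys xs} → Segment ys xs → All P xs → All P ys
  All-segment {ys = ys} (pre , post , refl) ps = Allₚ.++⁻ˡ ys (Allₚ.++⁻ʳ pre ps)

  Linked-segment : ∀ {R : A → A → Set} {ys xs} → Segment ys xs → Linked R xs → Linked R ys
  Linked-segment {R} {ys} (pre , post , refl) = take ys ∘ drop pre
    where
    drop : ∀ pre {zs} → Linked R (pre ++ zs) → Linked R zs
    drop [] rs = rs
    drop (x ∷ pre) rs = drop pre (Linked-tail rs)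
    take : ∀ xs {zs} → Linked R (xs ++ zs) → Linked R xs
    take [] rs = []
    take (x ∷ []) rs = [-]
    take (x ∷ y ∷ xs) (r ∷ rs) = r ∷ take (y ∷ xs) rs

  Unique-lookup-injective : ∀ {xs : List A} → Unique xs → ∀ i j → lookup xs i ≡ lookup xs j → i ≡ j
  Unique-lookup-injective (x∉ ∷ u) zero zero e = refl
  Unique-lookup-injective {_ ∷ xs} (x∉ ∷ u) zero (suc j) e =
    ⊥-elim (All.lookup x∉ (∈ₗₚ.∈-lookup {xs = xs} j) e)
  Unique-lookup-injective {_ ∷ xs} (x∉ ∷ u) (suc i) zero e =
    ⊥-elim (All.lookup x∉ (∈ₗₚ.∈-lookup {xs = xs} i) (sym e))
  Unique-lookup-injective (x∉ ∷ u) (suc i) (suc j) e = cong suc (Unique-lookup-injective u i j e)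

  Unique-prefix : ∀ (xs : List A) {ys} → Unique (xs ++ ys) → Unique xs
  Unique-prefix [] u = []
  Unique-prefix (x ∷ xs) (x∉ ∷ u) = Allₚ.++⁻ˡ xs x∉ ∷ Unique-prefix xs u

  Unique-middle : ∀ (xs : List A) {x ys} → Unique (xs ++ x ∷ ys) → All (x ≢_) xs
  Unique-middle [] u = []
  Unique-middle (z ∷ xs) (z∉ ∷ u) =
    (λ x≡z → All.lookup (Allₚ.++⁻ʳ xs z∉) (Any.here refl) (sym x≡z)) ∷ Unique-middle xs u

  Repetition : List A → Set
  Repetition xs = ∃₂ λ y mid → Unique (y ∷ mid) × Segment (y ∷ mid ++ [ y ]) xs

  unique-or-repetition : DecidableEquality A → (xs : List A) → Unique xs ⊎ Repetition xs
  unique-or-repetition _≟_ [] = inj₁ []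
  unique-or-repetition _≟_ (x ∷ xs) with unique-or-repetition _≟_ xs
  ... | inj₂ (y , mid , u , seg) = inj₂ (y , mid , u , Segment-∷ x seg)
  ... | inj₁ u with Any.any? (x ≟_) xs
  ...   | no x∉xs = inj₁ (Allₚ.¬Any⇒All¬ xs x∉xs ∷ u)
  ...   | yes x∈xs with ∈ₗₚ.∈-∃++ x∈xs
  ...     | mid , post , refl =
    inj₂ (x , mid , (Unique-middle mid u ∷ Unique-prefix mid u) , [] , post ,
          cong (x ∷_) (sym (Listₚ.++-assoc mid [ x ] post)))

Unique-length : ∀ {n} {xs : List (Fin n)} → Unique xs → length xs ≤ n
Unique-length {n} {xs} u with length xs ℕₚ.≤? n
... | yes len≤n = len≤n
... | no len≰n with Finₚ.pigeonhole (ℕₚ.≰⇒> len≰n) (lookup xs)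
...   | i , j , i<j , e = ⊥-elim (ℕₚ.<⇒≢ i<j (cong toℕ (Unique-lookup-injective u i j e)))

module _ {X Y : Set} where

  MapsTo : (X → Y) → ∀ {m n} → Vec X m → Vec Y n → Set
  MapsTo f = Pointwise (λ x y → f x ≡ y)

  MapsTo-map : ∀ (f : X → Y) {m} (xs : Vec X m) → MapsTo f xs (Vec.map f xs)
  MapsTo-map f [] = []
  MapsTo-map f (x ∷ xs) = refl ∷ MapsTo-map f xs

  MapsTo-∈ : ∀ {f : X → Y} {m n x} {xs : Vec X m} {ys : Vec Y n} → MapsTo f xs ys → x ∈ᵥ xs → f x ∈ᵥ ys
  MapsTo-∈ (fx≡y ∷ _) (here refl) = here fx≡y
  MapsTo-∈ (_ ∷ fxs≡ys) (there x∈) = there (MapsTo-∈ fxs≡ys x∈)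

  MapsTo-All⁺ : ∀ {f : X → Y} {P : X → Set} {Q : Y → Set} → (∀ {x} → P x → Q (f x)) →
    ∀ {m n} {xs : Vec X m} {ys : Vec Y n} → MapsTo f xs ys → VAll P xs → VAll Q ys
  MapsTo-All⁺ P⇒Q [] [] = []
  MapsTo-All⁺ P⇒Q (refl ∷ fxs≡ys) (px ∷ pxs) = P⇒Q px ∷ MapsTo-All⁺ P⇒Q fxs≡ys pxs

  MapsTo-All⁻ : ∀ {f : X → Y} {P : X → Set} {Q : Y → Set} → (∀ {x} → Q (f x) → P x) →
    ∀ {m n} {xs : Vec X m} {ys : Vec Y n} → MapsTo f xs ys → VAll Q ys → VAll P xs
  MapsTo-All⁻ Q⇒P [] [] = []
  MapsTo-All⁻ Q⇒P (refl ∷ fxs≡ys) (qy ∷ qys) = Q⇒P qy ∷ MapsTo-All⁻ Q⇒P fxs≡ys qys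

Pointwise-∈ : ∀ {A : Set} {m n x} {xs : Vec A m} {ys : Vec A n} → Pointwise _≡_ xs ys → x ∈ᵥ xs → x ∈ᵥ ys
Pointwise-∈ = MapsTo-∈ {f = id}

Pointwise-[] : ∀ {A A′ C : Set} {R : A → C → Set} {S : A′ → C → Set} {n} {ys : Vec C n} →
  Pointwise R [] ys → Pointwise S [] ys
Pointwise-[] [] = []

isBox? : (l : Label) → Dec (l ≡ box)
isBox? bot = no λ ()
isBox? top = no λ ()
isBox? (var x) = no λ ()
isBox? neg = no λ ()
isBox? box = yes refl
isBox? and = no λ ()
isBox? or = no λ ()
isBox? imp = no λ ()

module _ (G : Graph) where

  BoxWithin : ℕ → Fin (size G) → Set
  BoxWithin zero a = ⊥
  BoxWithin (suc k) a = IsBoxV G a ⊎ VAll (BoxWithin k) (succ G a)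

  -- Equivalent to the cycle condition, but evidently preserved by the graph constructors.
  Guarded : Set
  Guarded = (∀ a → Reach G a) × ∃[ k ] ∀ a → BoxWithin k a

  BoxWithin-mono : ∀ {k k′} → k ≤ k′ → ∀ {a} → BoxWithin k a → BoxWithin k′ a
  BoxWithin-mono {suc k} {suc k′} _ (inj₁ a□) = inj₁ a□
  BoxWithin-mono {suc k} {suc k′} (s≤s k≤k′) (inj₂ bs) = inj₂ (VAll.map (BoxWithin-mono k≤k′) bs)

  BoxWithin-succ : ∀ {k a s} → BoxWithin (suc k) a → ¬ IsBoxV G a → s ∈ᵥ succ G a → BoxWithin k s
  BoxWithin-succ (inj₁ a□) a∉□ _ = ⊥-elim (a∉□ a□)
  BoxWithin-succ (inj₂ bs) _ s∈ = VAll.lookup bs s∈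

  BoxWithin? : ∀ k a → Dec (BoxWithin k a)
  BoxWithin? zero a = no λ ()
  BoxWithin? (suc k) a with isBox? (lab G a) | VAll.all? (BoxWithin? k) (succ G a)
  ... | yes a□ | _ = yes (inj₁ a□)
  ... | no a∉□ | yes bs = yes (inj₂ bs)
  ... | no a∉□ | no ¬bs = no λ { (inj₁ a□) → a∉□ a□ ; (inj₂ bs) → ¬bs bs }

  -- Rotating a box-free closed walk by one step lowers the bound, so none exists.
  no-box-free-closed-walk : ∀ k v vs → Linked (Edge G) (v ∷ vs ++ [ v ]) →
    All (¬_ ∘ IsBoxV G) (v ∷ vs) → ¬ BoxWithin k v
  no-box-free-closed-walk (suc k) v vs walk (v∉□ ∷ _) (inj₁ v□) = v∉□ v□
  no-box-free-closed-walk (suc k) v [] (v→v ∷ [-]) vs∉□ (inj₂ bs) =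
    no-box-free-closed-walk k v [] (v→v ∷ [-]) vs∉□ (VAll.lookup bs v→v)
  no-box-free-closed-walk (suc k) v (s ∷ vs) (v→s ∷ walk) (v∉□ ∷ vs∉□) (inj₂ bs) =
    no-box-free-closed-walk k s (vs ++ [ v ]) rotated (Allₚ.++⁺ vs∉□ (v∉□ ∷ [])) (VAll.lookup bs v→s)
    where
    rotated : Linked (Edge G) (s ∷ (vs ++ [ v ]) ++ [ s ])
    rotated = Linked-snoc s vs walk v→s

  guarded⇒formula : Guarded → IsFormula G
  guarded⇒formula (reach , k , bounded) = reach , cycle-has-box
    where
    cycle-has-box : ∀ xs → IsCycle G xs → Any (IsBoxV G) xs
    cycle-has-box (v ∷ vs) (_ , walk) with Any.any? (isBox? ∘ lab G) (v ∷ vs)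
    ... | yes v□ = v□
    ... | no ¬v□ = ⊥-elim (no-box-free-closed-walk k v vs walk (Allₚ.¬Any⇒All¬ _ ¬v□) (bounded v))

  box-free-walk : ∀ k {a} → ¬ BoxWithin (suc k) a →
    ∃[ ws ] Linked (Edge G) (a ∷ ws) × All (¬_ ∘ IsBoxV G) (a ∷ ws) × length ws ≡ k
  box-free-walk zero a∉ = [] , [-] , (a∉ ∘ inj₁) ∷ [] , refl
  box-free-walk (suc k) {a} a∉ with VAll.decide (toSum ∘ BoxWithin? (suc k)) (succ G a)
  ... | inj₁ bs = ⊥-elim (a∉ (inj₂ bs))
  ... | inj₂ some with find some
  ...   | s , s∈ , s∉ with box-free-walk k s∉
  ...     | ws , walk , ws∉□ , len = s ∷ ws , s∈ ∷ walk , (a∉ ∘ inj₁) ∷ ws∉□ , cong suc len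

  -- A box-free walk with more vertices than the graph repeats a vertex, giving a box-free cycle.
  formula⇒guarded : IsFormula G → Guarded
  formula⇒guarded (reach , cycle-has-box) = reach , suc (size G) , bounded
    where
    bounded : ∀ a → BoxWithin (suc (size G)) a
    bounded a with BoxWithin? (suc (size G)) a
    ... | yes a-bounded = a-bounded
    ... | no a∉ with box-free-walk (size G) a∉
    ...   | ws , walk , ws∉□ , len with unique-or-repetition Finₚ._≟_ (a ∷ ws)
    ...     | inj₁ u = ⊥-elim (ℕₚ.<-irrefl len (Unique-length u))
    ...     | inj₂ (y , mid , u , seg@(pre , post , eq)) =
      ⊥-elim (Allₚ.All¬⇒¬Any (All-segment open-seg ws∉□)
        (cycle-has-box (y ∷ mid) (u , Linked-segment seg walk)))
      where
      open-seg : Segment (y ∷ mid) (a ∷ ws)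
      open-seg = pre , [ y ] ++ post ,
        trans eq (cong (λ zs → pre ++ y ∷ zs) (Listₚ.++-assoc mid [ y ] post))

IsHomAt : (H K : Graph) → (Fin (size H) → Fin (size K)) → Fin (size H) → Set
IsHomAt H K π a = lab H a ≡ lab K (π a) × MapsTo π (succ H a) (succ K (π a))

IsHom : (H K : Graph) → (Fin (size H) → Fin (size K)) → Set
IsHom H K π = ∀ a → IsHomAt H K π a

module _ {H K : Graph} {π : Fin (size H) → Fin (size K)} (hom : IsHom H K π) where

  IsHom-edge : ∀ {a b} → Edge H a b → Edge K (π a) (π b)
  IsHom-edge {a} = MapsTo-∈ (proj₂ (hom a))

  IsHom-reach : Reach K (π (root H)) → ∀ {a} → Reach H a → Reach K (π a)
  IsHom-reach r reach-root = r
  IsHom-reach r (reach-step ra a→b) = reach-step (IsHom-reach r ra) (IsHom-edge a→b)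

  IsHom-BoxWithin⁺ : ∀ k {a} → BoxWithin H k a → BoxWithin K k (π a)
  IsHom-BoxWithin⁺ (suc k) {a} (inj₁ a□) = inj₁ (trans (sym (proj₁ (hom a))) a□)
  IsHom-BoxWithin⁺ (suc k) {a} (inj₂ bs) = inj₂ (MapsTo-All⁺ (IsHom-BoxWithin⁺ k) (proj₂ (hom a)) bs)

  IsHom-BoxWithin⁻ : ∀ k {a} → BoxWithin K k (π a) → BoxWithin H k a
  IsHom-BoxWithin⁻ (suc k) {a} (inj₁ πa□) = inj₁ (trans (proj₁ (hom a)) πa□)
  IsHom-BoxWithin⁻ (suc k) {a} (inj₂ bs) = inj₂ (MapsTo-All⁻ (IsHom-BoxWithin⁻ k) (proj₂ (hom a)) bs)

IsHom-id : ∀ H → IsHom H H id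
IsHom-id H a = refl , Pw.refl refl

IsHom-≃ : ∀ {H₁ H₂ K π₁ π₂} → IsHom H₁ K π₁ → IsHom H₂ K π₂ →
  π₁ (root H₁) ≡ π₂ (root H₂) → H₁ ≃ H₂
IsHom-≃ {H₁} {H₂} {K} {π₁} {π₂} hom₁ hom₂ roots = (λ a₁ a₂ → π₁ a₁ ≡ π₂ a₂) , kernel-bisim , roots
  where
  kernel-bisim : IsBisim H₁ H₂ (λ a₁ a₂ → π₁ a₁ ≡ π₂ a₂)
  kernel-bisim a₁ a₂ e =
    trans (proj₁ (hom₁ a₁)) (trans (cong (lab K) e) (sym (proj₁ (hom₂ a₂)))) ,
    Pw.trans trans (subst (MapsTo π₁ (succ H₁ a₁) ∘ succ K) e (proj₂ (hom₁ a₁)))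
      (Pw.sym {Q = λ y x → y ≡ π₂ x} sym (proj₂ (hom₂ a₂)))

IsHomAt-embedded : ∀ {G L K ι π} (f : Fin (size L) → Fin (size K)) → IsHom G L ι → IsHom G K π →
  (∀ x → f (ι x) ≡ π x) → ∀ a → IsHomAt L K f (ι a)
IsHomAt-embedded {G} {L} {K} {ι} {π} f ι-hom π-hom f∘ι≗π a =
  trans (sym (proj₁ (ι-hom a))) (trans (proj₁ (π-hom a)) (cong (lab K) (sym (f∘ι≗π a)))) ,
  subst (MapsTo f (succ L (ι a)) ∘ succ K) (sym (f∘ι≗π a))
    (Pw.trans {P = λ y x → ι x ≡ y}
      (λ {_} {x} ιx≡y πx≡z → trans (cong f (sym ιx≡y)) (trans (f∘ι≗π x) πx≡z))
      (Pw.sym {Q = λ y x → ι x ≡ y} id (proj₂ (ι-hom a))) (proj₂ (π-hom a)))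

data SplitView (m n : ℕ) : Fin (m + n) → Set where
  left  : ∀ a → SplitView m n (a ↑ˡ n)
  right : ∀ b → SplitView m n (m ↑ʳ b)

splitView : ∀ m {n} (i : Fin (m + n)) → SplitView m n i
splitView m {n} i with splitAt m i in eq
... | inj₁ a = subst (SplitView m n) (Finₚ.splitAt⁻¹-↑ˡ eq) (left a)
... | inj₂ b = subst (SplitView m n) (Finₚ.splitAt⁻¹-↑ʳ eq) (right b)

vec1-∈ : ∀ u {n} (x : Fin n) → x ∈ᵥ vec1 u x
vec1-∈ uneg x = here refl
vec1-∈ ubox x = here refl

vec2-∈ˡ : ∀ b {n} (x y : Fin n) → x ∈ᵥ vec2 b x y
vec2-∈ˡ band x y = here refl
vec2-∈ˡ bor x y = here refl
vec2-∈ˡ bimp x y = here refl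

vec2-∈ʳ : ∀ b {n} (x y : Fin n) → y ∈ᵥ vec2 b x y
vec2-∈ʳ band x y = there (here refl)
vec2-∈ʳ bor x y = there (here refl)
vec2-∈ʳ bimp x y = there (here refl)

vec2-All : ∀ b {n} {P : Fin n → Set} {x y} → P x → P y → VAll P (vec2 b x y)
vec2-All band px py = px ∷ py ∷ []
vec2-All bor px py = px ∷ py ∷ []
vec2-All bimp px py = px ∷ py ∷ []

blab≢box : ∀ o → blab o ≢ box
blab≢box band ()
blab≢box bor ()
blab≢box bimp ()

vec1-MapsTo : ∀ u {m n} {f : Fin m → Fin n} {x k} {ys : Vec (Fin n) k} →
  Pointwise _≡_ (f x ∷ []) ys → MapsTo f (vec1 u x) ys
vec1-MapsTo uneg (fx≡ ∷ []) = fx≡ ∷ []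
vec1-MapsTo ubox (fx≡ ∷ []) = fx≡ ∷ []

vec2-MapsTo : ∀ o {m n} {f : Fin m → Fin n} {x y k} {ys : Vec (Fin n) k} →
  Pointwise _≡_ (f x ∷ f y ∷ []) ys → MapsTo f (vec2 o x y) ys
vec2-MapsTo band (fx≡ ∷ fy≡ ∷ []) = fx≡ ∷ fy≡ ∷ []
vec2-MapsTo bor (fx≡ ∷ fy≡ ∷ []) = fx≡ ∷ fy≡ ∷ []
vec2-MapsTo bimp (fx≡ ∷ fy≡ ∷ []) = fx≡ ∷ fy≡ ∷ []

unG-embed : ∀ u G → IsHom G (unG u G) suc
unG-embed u G a = refl , MapsTo-map suc (succ G a)

unG-hom : ∀ {u G K π t} → IsHom G K π →
  IsHomAt (unG u G) K (t VF.∷ π) zero → IsHom (unG u G) K (t VF.∷ π)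
unG-hom hom at-root zero = at-root
unG-hom {u} {G} {K} {π} {t} hom at-root (suc a) =
  IsHomAt-embedded {G} {unG u G} {K} (t VF.∷ π) (unG-embed u G) hom (λ _ → refl) a

module _ (b : B) (G H : Graph) where

  binG-embedˡ : IsHom G (binG b G H) (λ a → suc (a ↑ˡ size H))
  binG-embedˡ a rewrite Finₚ.splitAt-↑ˡ (size G) a (size H) = refl , MapsTo-map _ (succ G a)

  binG-embedʳ : IsHom H (binG b G H) (λ a → suc (size G ↑ʳ a))
  binG-embedʳ a rewrite Finₚ.splitAt-↑ʳ (size G) (size H) a = refl , MapsTo-map _ (succ H a)

  binG-hom : ∀ {K π₁ π₂ t} → IsHom G K π₁ → IsHom H K π₂ →
    IsHomAt (binG b G H) K (t VF.∷ (π₁ VF.++ π₂)) zero → IsHom (binG b G H) K (t VF.∷ (π₁ VF.++ π₂))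
  binG-hom hom₁ hom₂ at-root zero = at-root
  binG-hom {K} {π₁} {π₂} {t} hom₁ hom₂ at-root (suc i) with splitView (size G) i
  ... | left a = IsHomAt-embedded {G} {binG b G H} {K} f binG-embedˡ hom₁ (VFₚ.lookup-++ˡ π₁ π₂) a
    where f = t VF.∷ (π₁ VF.++ π₂)
  ... | right a = IsHomAt-embedded {H} {binG b G H} {K} f binG-embedʳ hom₂ (VFₚ.lookup-++ʳ π₁ π₂) a
    where f = t VF.∷ (π₁ VF.++ π₂)

□•G-embed : ∀ G → IsHom G (□•G G) (λ a → suc (suc a))
□•G-embed G a = refl , MapsTo-map _ (succ G a)

unG-guarded : ∀ u G → Guarded G → Guarded (unG u G)
unG-guarded u G (reach , k , bounded) = reach′ , suc k , bounded′
  where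
  root-bounded : ∀ u → BoxWithin (unG u G) (suc k) zero
  root-bounded uneg = inj₂ (IsHom-BoxWithin⁺ (unG-embed uneg G) k (bounded (root G)) ∷ [])
  root-bounded ubox = inj₁ refl
  reach′ : ∀ a → Reach (unG u G) a
  reach′ zero = reach-root
  reach′ (suc a) = IsHom-reach (unG-embed u G) (reach-step reach-root (vec1-∈ u _)) (reach a)
  bounded′ : ∀ a → BoxWithin (unG u G) (suc k) a
  bounded′ zero = root-bounded u
  bounded′ (suc a) = BoxWithin-mono _ (ℕₚ.n≤1+n k) (IsHom-BoxWithin⁺ (unG-embed u G) k (bounded a))

binG-guarded : ∀ b G H → Guarded G → Guarded H → Guarded (binG b G H)
binG-guarded b G H (reachG , k₁ , boundedG) (reachH , k₂ , boundedH) = reach , suc k , bounded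
  where
  k = k₁ ⊔ k₂
  boundedˡ : ∀ a → BoxWithin (binG b G H) k (suc (a ↑ˡ size H))
  boundedˡ a = IsHom-BoxWithin⁺ (binG-embedˡ b G H) k (BoxWithin-mono G (ℕₚ.m≤m⊔n k₁ k₂) (boundedG a))
  boundedʳ : ∀ a → BoxWithin (binG b G H) k (suc (size G ↑ʳ a))
  boundedʳ a = IsHom-BoxWithin⁺ (binG-embedʳ b G H) k (BoxWithin-mono H (ℕₚ.m≤n⊔m k₁ k₂) (boundedH a))
  reach : ∀ a → Reach (binG b G H) a
  reach zero = reach-root
  reach (suc i) with splitView (size G) i
  ... | left a = IsHom-reach (binG-embedˡ b G H) (reach-step reach-root (vec2-∈ˡ b _ _)) (reachG a)
  ... | right a = IsHom-reach (binG-embedʳ b G H) (reach-step reach-root (vec2-∈ʳ b _ _)) (reachH a)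
  bounded : ∀ a → BoxWithin (binG b G H) (suc k) a
  bounded zero = inj₂ (vec2-All b (boundedˡ (root G)) (boundedʳ (root H)))
  bounded (suc i) with splitView (size G) i
  ... | left a = BoxWithin-mono _ (ℕₚ.n≤1+n k) (boundedˡ a)
  ... | right a = BoxWithin-mono _ (ℕₚ.n≤1+n k) (boundedʳ a)

□•G-guarded : ∀ G → Guarded G → Guarded (□•G G)
□•G-guarded G (reach , k , bounded) = reach′ , suc (suc k) , bounded′
  where
  embedded : ∀ a → BoxWithin (□•G G) k (suc (suc a))
  embedded a = IsHom-BoxWithin⁺ (□•G-embed G) k (bounded a)
  reach′ : ∀ a → Reach (□•G G) a
  reach′ zero = reach-root
  reach′ (suc zero) = reach-step reach-root (here refl)
  reach′ (suc (suc a)) =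
    IsHom-reach (□•G-embed G) (reach-step (reach-step reach-root (here refl)) (here refl)) (reach a)
  bounded′ : ∀ a → BoxWithin (□•G G) (suc (suc k)) a
  bounded′ zero = inj₁ refl
  bounded′ (suc zero) = inj₂ (BoxWithin-mono _ (ℕₚ.n≤1+n k) (embedded (root G)) ∷ inj₁ refl ∷ [])
  bounded′ (suc (suc a)) = BoxWithin-mono _ (ℕₚ.m≤n+m k 2) (embedded a)

treeG-guarded : ∀ A → Guarded (treeG A)
treeG-guarded ⊥ᶠ = (λ { zero → reach-root }) , 1 , λ { zero → inj₂ [] }
treeG-guarded ⊤ᶠ = (λ { zero → reach-root }) , 1 , λ { zero → inj₂ [] }
treeG-guarded (varᶠ p) = (λ { zero → reach-root }) , 1 , λ { zero → inj₂ [] }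
treeG-guarded (¬ᶠ A) = unG-guarded uneg _ (treeG-guarded A)
treeG-guarded (□ᶠ A) = unG-guarded ubox _ (treeG-guarded A)
treeG-guarded (A ∧ᶠ B) = binG-guarded band _ _ (treeG-guarded A) (treeG-guarded B)
treeG-guarded (A ∨ᶠ B) = binG-guarded bor _ _ (treeG-guarded A) (treeG-guarded B)
treeG-guarded (A ⇒ᶠ B) = binG-guarded bimp _ _ (treeG-guarded A) (treeG-guarded B)

□-⊡•G≃□•G : ∀ G → □G (⊡•G G) ≃ □•G G
□-⊡•G≃□•G G = IsHom-≃ {K = □•G G} □-⊡•-hom (IsHom-id (□•G G)) refl
  where
  π₁ : Fin (size G) → Fin (size (□•G G))
  π₁ a = suc (suc a)
  ⊡•-hom : IsHom (⊡•G G) (□•G G) (suc zero VF.∷ (π₁ VF.++ id))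
  ⊡•-hom = binG-hom band G (□•G G) {□•G G} (□•G-embed G) (IsHom-id (□•G G))
    (refl , VFₚ.lookup-++ˡ π₁ id (root G) ∷ VFₚ.lookup-++ʳ π₁ id zero ∷ [])
  □-⊡•-hom : IsHom (□G (⊡•G G)) (□•G G) (zero VF.∷ (suc zero VF.∷ (π₁ VF.++ id)))
  □-⊡•-hom = unG-hom {ubox} {⊡•G G} {□•G G} ⊡•-hom (refl , refl ∷ [])

-- The subgraph generated by a vertex

module Generated (G : Graph) (c : Fin (size G)) where

  private
    n = size G

  Reachable : Fin n → Set
  Reachable = Reach (record G { root = c })

  Invariant : Subset n → Set
  Invariant S = c ∈ S × (∀ {x} → x ∈ S → Reachable x)

  Closed : Subset n → Set
  Closed S = ∀ {a b} → a ∈ S → Edge G a b → b ∈ S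

  closed-or-exit : ∀ S → Closed S ⊎ ∃₂ λ a b → a ∈ S × Edge G a b × b ∉ S
  closed-or-exit S with Finₚ.any? (λ a → (a ∈? S) ×-dec VAny.any? (λ b → ¬? (b ∈? S)) (succ G a))
  ... | yes (a , a∈S , exits) = let b , a→b , b∉S = find exits in inj₂ (a , b , a∈S , a→b , b∉S)
  ... | no ¬exit = inj₁ closed
    where
    closed : Closed S
    closed {a} {b} a∈S a→b with b ∈? S
    ... | yes b∈S = b∈S
    ... | no b∉S = ⊥-elim (¬exit (a , a∈S , lose a→b b∉S))

  -- Each round adds a missing successor; the fuel bound fails before S can outgrow Fin n.
  grow : ∀ fuel S → n < fuel + ∣ S ∣ → Invariant S → ∃ λ S → Invariant S × Closed S
  grow zero S n<∣S∣ _ = ⊥-elim (ℕₚ.<⇒≱ n<∣S∣ (Subsetₚ.∣p∣≤n S))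
  grow (suc fuel) S n<fuel+∣S∣ inv@(c∈S , reachable) with closed-or-exit S
  ... | inj₁ closed = S , inv , closed
  ... | inj₂ (a , b , a∈S , a→b , b∉S) =
    grow fuel (S ∪ ⁅ b ⁆) bound (Subsetₚ.p⊆p∪q ⁅ b ⁆ c∈S , reachable′)
    where
    S⊂S′ : S ⊂ S ∪ ⁅ b ⁆
    S⊂S′ = Subsetₚ.p⊆p∪q ⁅ b ⁆ , b , Subsetₚ.q⊆p∪q S ⁅ b ⁆ (Subsetₚ.x∈⁅x⁆ b) , b∉S
    bound : n < fuel + ∣ S ∪ ⁅ b ⁆ ∣
    bound = ℕₚ.<-≤-trans n<fuel+∣S∣
      (subst (_≤ fuel + ∣ S ∪ ⁅ b ⁆ ∣) (ℕₚ.+-suc fuel ∣ S ∣)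
        (ℕₚ.+-monoʳ-≤ fuel (Subsetₚ.p⊂q⇒∣p∣<∣q∣ S⊂S′)))
    reachable′ : ∀ {x} → x ∈ S ∪ ⁅ b ⁆ → Reachable x
    reachable′ {x} x∈ with Subsetₚ.x∈p∪q⁻ S ⁅ b ⁆ x∈
    ... | inj₁ x∈S = reachable x∈S
    ... | inj₂ x∈⁅b⁆ rewrite Subsetₚ.x∈⁅y⁆⇒x≡y b x∈⁅b⁆ = reach-step (reachable a∈S) a→b

  generated : ∃ λ S → Invariant S × Closed S
  generated = grow (suc n) ⁅ c ⁆ (ℕₚ.m≤m+n (suc n) _) (Subsetₚ.x∈⁅x⁆ c , ⁅c⁆-reachable)
    where
    ⁅c⁆-reachable : ∀ {x} → x ∈ ⁅ c ⁆ → Reachable x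
    ⁅c⁆-reachable x∈ rewrite Subsetₚ.x∈⁅y⁆⇒x≡y c x∈ = reach-root

  S : Subset n
  S = proj₁ generated

  c∈S : c ∈ S
  c∈S = proj₁ (proj₁ (proj₂ generated))

  S-reachable : ∀ {x} → x ∈ S → Reachable x
  S-reachable = proj₂ (proj₁ (proj₂ generated))

  S-closed : Closed S
  S-closed = proj₂ (proj₂ generated)

  vertices : List (Fin n)
  vertices = filter (_∈? S) (allFin n)

  ∈-vertices : ∀ {x} → x ∈ S → x ∈ₗ vertices
  ∈-vertices = ∈ₗₚ.∈-filter⁺ (_∈? S) (∈ₗₚ.∈-allFin _)

  vertex : Fin (length vertices) → Fin n
  vertex = lookup vertices

  vertex-∈ : ∀ i → vertex i ∈ S
  vertex-∈ i = proj₂ (∈ₗₚ.∈-filter⁻ (_∈? S) {xs = allFin n} (∈ₗₚ.∈-lookup {xs = vertices} i))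

  -- Outside S the index is junk (that of c); it is only used on members of S.
  index : Fin n → Fin (length vertices)
  index x with x ∈? S
  ... | yes x∈S = Any.index (∈-vertices x∈S)
  ... | no _ = Any.index (∈-vertices c∈S)

  vertex-index : ∀ {x} → x ∈ S → vertex (index x) ≡ x
  vertex-index {x} x∈S with x ∈? S
  ... | yes x∈S = sym (Anyₚ.lookup-index (∈-vertices x∈S))
  ... | no x∉S = ⊥-elim (x∉S x∈S)

  index-vertex : ∀ i → index (vertex i) ≡ i
  index-vertex i =
    Unique-lookup-injective (Uniqueₚ.filter⁺ (_∈? S) (Uniqueₚ.allFin⁺ n)) _ _ (vertex-index (vertex-∈ i))

  subgraph : Graph
  subgraph = record
    { size = length vertices
    ; root = index c
    ; lab = lab G ∘ vertex
    ; succ = λ i → Vec.map index (succ G (vertex i))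
    }

  vertex-hom : IsHom subgraph G vertex
  vertex-hom i = refl , index-retract (succ G (vertex i)) (S-closed (vertex-∈ i))
    where
    index-retract : ∀ {m} (xs : Vec (Fin n) m) → (∀ {x} → x ∈ᵥ xs → x ∈ S) →
      MapsTo vertex (Vec.map index xs) xs
    index-retract [] _ = []
    index-retract (x ∷ xs) xs⊆S = vertex-index (xs⊆S (here refl)) ∷ index-retract xs (xs⊆S ∘ there)

  reach-index : ∀ {x} → Reachable x → Reach subgraph (index x)
  reach-index reach-root = reach-root
  reach-index (reach-step {a} {b} ra a→b) = reach-step (reach-index ra)
    (subst (λ v → index b ∈ᵥ Vec.map index (succ G v)) (sym (vertex-index (S-closed′ ra)))
      (Vecₚ.∈-map⁺ index a→b))
    where
    S-closed′ : ∀ {x} → Reachable x → x ∈ S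
    S-closed′ reach-root = c∈S
    S-closed′ (reach-step r e) = S-closed (S-closed′ r) e

  subgraph-guarded : Guarded G → Guarded subgraph
  subgraph-guarded (_ , k , bounded) =
    (λ i → subst (Reach subgraph) (index-vertex i) (reach-index (S-reachable (vertex-∈ i)))) ,
    k , λ i → IsHom-BoxWithin⁻ vertex-hom k (bounded (vertex i))

  vertex-root : vertex (root subgraph) ≡ c
  vertex-root = vertex-index c∈S

-- Tautologies and derived rules of CHL

record Formula : Set where
  constructor formula
  field
    graph : Graph
    guarded : Guarded graph
open Formula

treeF : Fm → Formula
treeF A = formula (treeG A) (treeG-guarded A)

⊤F : Formula
⊤F = treeF ⊤ᶠ

¬F □F □•F : Formula → Formula
¬F A = formula (¬G (graph A)) (unG-guarded uneg _ (guarded A))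
□F A = formula (□G (graph A)) (unG-guarded ubox _ (guarded A))
□•F A = formula (□•G (graph A)) (□•G-guarded _ (guarded A))

binF : B → Formula → Formula → Formula
binF b A C = formula (binG b (graph A) (graph C)) (binG-guarded b _ _ (guarded A) (guarded C))

_∧F_ _∨F_ _⇒F_ _⇔F_ : Formula → Formula → Formula
_∧F_ = binF band
_∨F_ = binF bor
_⇒F_ = binF bimp
A ⇔F C = (A ⇒F C) ∧F (C ⇒F A)

infixr 6 _∧F_
infixr 5 _⇒F_
infix 4 _⇔F_

⊡•F : Formula → Formula
⊡•F A = A ∧F □•F A

⋀F : List Formula → Formula
⋀F = foldr _∧F_ ⊤F

⋀G-graph : ∀ As → ⋀G (map graph As) ≡ graph (⋀F As)
⋀G-graph [] = refl
⋀G-graph (A ∷ As) = cong (graph A ∧G_) (⋀G-graph As)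

AtomsBelow : ℕ → PF → Set
AtomsBelow n ⊥ᵖ = ⊤
AtomsBelow n ⊤ᵖ = ⊤
AtomsBelow n (atom p) = T (p <ᵇ n)
AtomsBelow n (¬ᵖ P) = AtomsBelow n P
AtomsBelow n (P ∧ᵖ Q) = AtomsBelow n P × AtomsBelow n Q
AtomsBelow n (P ∨ᵖ Q) = AtomsBelow n P × AtomsBelow n Q
AtomsBelow n (P ⇒ᵖ Q) = AtomsBelow n P × AtomsBelow n Q

valuation : ∀ {n} → Vec Bool n → ℕ → Bool
valuation [] p = false
valuation (b ∷ bs) zero = b
valuation (b ∷ bs) (suc p) = valuation bs p

AllValuations : ∀ n → (Vec Bool n → Bool) → Set
AllValuations zero f = T (f [])
AllValuations (suc n) f = AllValuations n (f ∘ (true ∷_)) × AllValuations n (f ∘ (false ∷_))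

AllValuations-sound : ∀ n {f} → AllValuations n f → ∀ bs → T (f bs)
AllValuations-sound zero holds [] = holds
AllValuations-sound (suc n) (holds , _) (true ∷ bs) = AllValuations-sound n holds bs
AllValuations-sound (suc n) (_ , holds) (false ∷ bs) = AllValuations-sound n holds bs

truncate : ∀ n → (ℕ → Bool) → Vec Bool n
truncate zero v = []
truncate (suc n) v = v zero ∷ truncate n (v ∘ suc)

valuation-truncate : ∀ {n p} v → p < n → valuation (truncate n v) p ≡ v p
valuation-truncate {p = zero} v (s≤s _) = refl
valuation-truncate {p = suc p} v (s≤s p<n) = valuation-truncate (v ∘ suc) p<n

evalP-local : ∀ {n} P v w → AtomsBelow n P → (∀ {p} → p < n → v p ≡ w p) → evalP v P ≡ evalP w P
evalP-local ⊥ᵖ v w _ _ = refl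
evalP-local ⊤ᵖ v w _ _ = refl
evalP-local {n} (atom p) v w p<n v≗w = v≗w (ℕₚ.<ᵇ⇒< p n p<n)
evalP-local (¬ᵖ P) v w below v≗w = cong not (evalP-local P v w below v≗w)
evalP-local (P ∧ᵖ Q) v w (bP , bQ) v≗w = cong₂ _∧_ (evalP-local P v w bP v≗w) (evalP-local Q v w bQ v≗w)
evalP-local (P ∨ᵖ Q) v w (bP , bQ) v≗w = cong₂ _∨_ (evalP-local P v w bP v≗w) (evalP-local Q v w bQ v≗w)
evalP-local (P ⇒ᵖ Q) v w (bP , bQ) v≗w =
  cong₂ (λ x y → not x ∨ y) (evalP-local P v w bP v≗w) (evalP-local Q v w bQ v≗w)

Valid : ℕ → PF → Set
Valid n P = AtomsBelow n P × AllValuations n (λ bs → evalP (valuation bs) P)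

Valid⇒Tautology : ∀ n P → Valid n P → Tautology P
Valid⇒Tautology n P (below , holds) v =
  trans (evalP-local P v (valuation (truncate n v)) below (λ p<n → sym (valuation-truncate v p<n)))
    (Equivalence.to T-≡ (AllValuations-sound n holds (truncate n v)))

-- Atoms beyond the given formulas are sent to ⊤ (any formula would do).
instantiate : ∀ {n} → Vec Formula n → ℕ → Formula
instantiate [] p = ⊤F
instantiate (A ∷ As) zero = A
instantiate (A ∷ As) (suc p) = instantiate As p

tautology : ∀ {n} (P : PF) (As : Vec Formula n) {_ : Valid n P} →
  ⊢CHL substG P (graph ∘ instantiate As)
tautology {n} P As {valid} = taut P (Valid⇒Tautology n P valid) (graph ∘ instantiate As)
  (λ p → guarded⇒formula _ (guarded (instantiate As p)))

-- Records rather than synonyms, so that the formulas can be inferred from the types.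
record ⊢_ (A : Formula) : Set₁ where
  constructor ⊢-intro
  field ⊢-proof : ⊢CHL (graph A)
open ⊢_

record _⊩_ (Γ A : Formula) : Set₁ where
  constructor ⊩-intro
  field ⊩-proof : ⊢CHL (graph Γ ⇒G graph A)
open _⊩_

infix 2 ⊢_ _⊩_

p₀ p₁ p₂ p₃ p₄ : PF
p₀ = atom 0
p₁ = atom 1
p₂ = atom 2
p₃ = atom 3
p₄ = atom 4

_⊃_ _&_ _⇔ᵖ_ : PF → PF → PF
_⊃_ = _⇒ᵖ_
_&_ = _∧ᵖ_
P ⇔ᵖ Q = (P ⊃ Q) & (Q ⊃ P)

infixr 6 _&_
infixr 5 _⊃_
infix 4 _⇔ᵖ_

module _ {Γ : Formula} where

  weaken : ∀ {A} → ⊢ A → Γ ⊩ A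
  weaken {A} (⊢-intro a) = ⊩-intro (mp a (tautology (p₀ ⊃ p₁ ⊃ p₀) (A ∷ Γ ∷ [])))

  assumption : Γ ⊩ Γ
  assumption = ⊩-intro (tautology (p₀ ⊃ p₀) (Γ ∷ []))

  cut : ∀ {A C} → Γ ⊩ A → A ⊩ C → Γ ⊩ C
  cut {A} {C} (⊩-intro a) (⊩-intro a⇒c) =
    ⊩-intro (mp a⇒c (mp a (tautology ((p₀ ⊃ p₁) ⊃ (p₁ ⊃ p₂) ⊃ p₀ ⊃ p₂) (Γ ∷ A ∷ C ∷ []))))

  ⊤-intro : Γ ⊩ ⊤F
  ⊤-intro = ⊩-intro (tautology (p₀ ⊃ ⊤ᵖ) (Γ ∷ []))

  ∧-intro : ∀ {A C} → Γ ⊩ A → Γ ⊩ C → Γ ⊩ A ∧F C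
  ∧-intro {A} {C} (⊩-intro a) (⊩-intro c) =
    ⊩-intro (mp c (mp a (tautology ((p₀ ⊃ p₁) ⊃ (p₀ ⊃ p₂) ⊃ p₀ ⊃ p₁ & p₂) (Γ ∷ A ∷ C ∷ []))))

  ∧-elimˡ : ∀ {A C} → Γ ⊩ A ∧F C → Γ ⊩ A
  ∧-elimˡ {A} {C} (⊩-intro ac) = ⊩-intro (mp ac (tautology ((p₀ ⊃ p₁ & p₂) ⊃ p₀ ⊃ p₁) (Γ ∷ A ∷ C ∷ [])))

  ∧-elimʳ : ∀ {A C} → Γ ⊩ A ∧F C → Γ ⊩ C
  ∧-elimʳ {A} {C} (⊩-intro ac) = ⊩-intro (mp ac (tautology ((p₀ ⊃ p₁ & p₂) ⊃ p₀ ⊃ p₂) (Γ ∷ A ∷ C ∷ [])))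

  ⇒-intro : ∀ {A C} → Γ ∧F A ⊩ C → Γ ⊩ A ⇒F C
  ⇒-intro {A} {C} (⊩-intro c) = ⊩-intro (mp c (tautology ((p₀ & p₁ ⊃ p₂) ⊃ p₀ ⊃ p₁ ⊃ p₂) (Γ ∷ A ∷ C ∷ [])))

  ⇒-elim : ∀ {A C} → Γ ⊩ A ⇒F C → Γ ⊩ A → Γ ⊩ C
  ⇒-elim {A} {C} (⊩-intro a⇒c) (⊩-intro a) =
    ⊩-intro (mp a (mp a⇒c (tautology ((p₀ ⊃ p₁ ⊃ p₂) ⊃ (p₀ ⊃ p₁) ⊃ p₀ ⊃ p₂) (Γ ∷ A ∷ C ∷ []))))

  ⇔-trans : ∀ {A C D} → Γ ⊩ A ⇔F C → Γ ⊩ C ⇔F D → Γ ⊩ A ⇔F D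
  ⇔-trans {A} {C} {D} (⊩-intro ac) (⊩-intro cd) = ⊩-intro (mp cd (mp ac
    (tautology ((p₀ ⊃ (p₁ ⇔ᵖ p₂)) ⊃ (p₀ ⊃ (p₂ ⇔ᵖ p₃)) ⊃ p₀ ⊃ (p₁ ⇔ᵖ p₃)) (Γ ∷ A ∷ C ∷ D ∷ []))))

  ¬-cong : ∀ {A C} → Γ ⊩ A ⇔F C → Γ ⊩ ¬F A ⇔F ¬F C
  ¬-cong {A} {C} (⊩-intro ac) =
    ⊩-intro (mp ac (tautology ((p₀ ⊃ (p₁ ⇔ᵖ p₂)) ⊃ p₀ ⊃ (¬ᵖ p₁ ⇔ᵖ ¬ᵖ p₂)) (Γ ∷ A ∷ C ∷ [])))

  bin-cong : ∀ b {A C D E} → Γ ⊩ A ⇔F C → Γ ⊩ D ⇔F E → Γ ⊩ binF b A D ⇔F binF b C E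
  bin-cong band {A} {C} {D} {E} (⊩-intro ac) (⊩-intro de) = ⊩-intro (mp de (mp ac (tautology
    ((p₀ ⊃ (p₁ ⇔ᵖ p₂)) ⊃ (p₀ ⊃ (p₃ ⇔ᵖ p₄)) ⊃ p₀ ⊃ (p₁ & p₃ ⇔ᵖ p₂ & p₄))
    (Γ ∷ A ∷ C ∷ D ∷ E ∷ []))))
  bin-cong bor {A} {C} {D} {E} (⊩-intro ac) (⊩-intro de) = ⊩-intro (mp de (mp ac (tautology
    ((p₀ ⊃ (p₁ ⇔ᵖ p₂)) ⊃ (p₀ ⊃ (p₃ ⇔ᵖ p₄)) ⊃ p₀ ⊃ (p₁ ∨ᵖ p₃ ⇔ᵖ p₂ ∨ᵖ p₄))
    (Γ ∷ A ∷ C ∷ D ∷ E ∷ []))))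
  bin-cong bimp {A} {C} {D} {E} (⊩-intro ac) (⊩-intro de) = ⊩-intro (mp de (mp ac (tautology
    ((p₀ ⊃ (p₁ ⇔ᵖ p₂)) ⊃ (p₀ ⊃ (p₃ ⇔ᵖ p₄)) ⊃ p₀ ⊃ ((p₁ ⊃ p₃) ⇔ᵖ (p₂ ⊃ p₄)))
    (Γ ∷ A ∷ C ∷ D ∷ E ∷ []))))

K : ∀ {A C} → □F (A ⇒F C) ⊩ □F A ⇒F □F C
K {A} {C} = ⊩-intro (axK _ _ (guarded⇒formula _ (guarded A)) (guarded⇒formula _ (guarded C)))

□-mono : ∀ {A C} → A ⊩ C → □F A ⊩ □F C
□-mono {A} {C} (⊩-intro a⇒c) = ⊩-intro (mp (nec a⇒c) (⊩-proof (K {A} {C})))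

□-∧ : ∀ {A C} → □F A ∧F □F C ⊩ □F (A ∧F C)
□-∧ = ⇒-elim (cut (∧-elimˡ assumption) (cut (□-mono (⇒-intro assumption)) K)) (∧-elimʳ assumption)

□-cong : ∀ {Γ A C} → Γ ⊩ □F (A ⇔F C) → Γ ⊩ □F A ⇔F □F C
□-cong □a⇔c =
  ∧-intro (cut □a⇔c (cut (□-mono (∧-elimˡ assumption)) K)) (cut □a⇔c (cut (□-mono (∧-elimʳ assumption)) K))

necessitation : ∀ {A} → ⊢ A → ⊢ □F A
necessitation (⊢-intro a) = ⊢-intro (nec a)

löb-rule : ∀ {A} → ⊢ □F A ⇒F A → ⊢ A
löb-rule (⊢-intro □a⇒a) = ⊢-intro (löb □a⇒a)

≃⇒⇔ : ∀ {A C} → graph A ≃ graph C → ⊢ A ⇔F C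
≃⇒⇔ {A} {C} A≃C = ⊢-intro (bisim _ _ (guarded⇒formula _ (guarded A)) (guarded⇒formula _ (guarded C)) A≃C)

⋀-elim : ∀ {A As} → A ∈ₗ As → ⋀F As ⊩ A
⋀-elim (Any.here refl) = ∧-elimˡ assumption
⋀-elim (Any.there A∈As) = cut (∧-elimʳ assumption) (⋀-elim A∈As)

⋀-intro : ∀ {Γ As} → All (Γ ⊩_) As → Γ ⊩ ⋀F As
⋀-intro [] = ⊤-intro
⋀-intro (a ∷ as) = ∧-intro a (⋀-intro as)

⋀-□ : ∀ {As} → All (λ A → A ⊩ □F A) As → ⋀F As ⊩ □F (⋀F As)
⋀-□ [] = weaken (necessitation (⊢-intro (tautology ⊤ᵖ [])))
⋀-□ (a ∷ as) = cut (∧-intro (cut (∧-elimˡ assumption) a) (cut (∧-elimʳ assumption) (⋀-□ as))) □-∧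

⊡•-□ : ∀ {A} → ⊡•F A ⊩ □F (⊡•F A)
⊡•-□ {A} =
  ⇒-elim (∧-elimʳ (weaken (≃⇒⇔ {□F (⊡•F A)} {□•F A} (□-⊡•G≃□•G (graph A))))) (∧-elimʳ assumption)

⊩⇒⊢ : ∀ {Γ A} → Γ ⊩ A → ⊢ Γ ⇒F A
⊩⇒⊢ (⊩-intro p) = ⊢-intro p

⊢⇒⊩ : ∀ {Γ A} → ⊢ Γ ⇒F A → Γ ⊩ A
⊢⇒⊩ (⊢-intro p) = ⊩-intro p

module _ (φ : Graph) (q : Fin (size φ) → ℕ) where

  private
    n = size φ

  ψ : ℕ → Fin n → Formula
  ψ k b = treeF (Efuel φ q k b)

  -- One unfolding of Efuel at b, with b's label and successors as arguments that can be split on.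
  node : ℕ → Fin n → (l : Label) → Vec (Fin n) (arity l) → Fm
  node k b bot [] = ⊥ᶠ
  node k b top [] = ⊤ᶠ
  node k b (var p) [] = varᶠ p
  node k b neg (s ∷ []) = ¬ᶠ (Efuel φ q k s)
  node k b box (c ∷ []) = varᶠ (q b)
  node k b and (s₁ ∷ s₂ ∷ []) = Efuel φ q k s₁ ∧ᶠ Efuel φ q k s₂
  node k b or (s₁ ∷ s₂ ∷ []) = Efuel φ q k s₁ ∨ᶠ Efuel φ q k s₂
  node k b imp (s₁ ∷ s₂ ∷ []) = Efuel φ q k s₁ ⇒ᶠ Efuel φ q k s₂

  Efuel-node : ∀ k b → Efuel φ q (suc k) b ≡ node k b (lab φ b) (succ φ b)
  Efuel-node k b with lab φ b | succ φ b
  ... | bot | [] = refl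
  ... | top | [] = refl
  ... | var p | [] = refl
  ... | neg | s ∷ [] = refl
  ... | box | c ∷ [] = refl
  ... | and | s₁ ∷ s₂ ∷ [] = refl
  ... | or | s₁ ∷ s₂ ∷ [] = refl
  ... | imp | s₁ ∷ s₂ ∷ [] = refl

  node-cong : ∀ {X : Set} (f : (l : Label) → Vec (Fin n) (arity l) → X) {b l cs} →
    lab φ b ≡ l → Pointwise _≡_ cs (succ φ b) → f l cs ≡ f (lab φ b) (succ φ b)
  node-cong f {b} e cs≡ with lab φ b | succ φ b
  node-cong f refl cs≡ | l | cs′ = cong (f l) (Pw.Pointwise-≡⇒≡ cs≡)

  hypothesis : Fin n → Fin n → Formula
  hypothesis a c = treeF (varᶠ (q a)) ⇔F □F (ψ (suc n) c)

  hypothesesAt : Fin n → (l : Label) → Vec (Fin n) (arity l) → List Formula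
  hypothesesAt a box (c ∷ []) = [ hypothesis a c ]
  hypothesesAt a _ _ = []

  hypAt-graph : ∀ a l cs → hypAt φ q a l cs ≡ map (graph ∘ ⊡•F) (hypothesesAt a l cs)
  hypAt-graph a bot [] = refl
  hypAt-graph a top [] = refl
  hypAt-graph a (var p) [] = refl
  hypAt-graph a neg (s ∷ []) = refl
  hypAt-graph a box (c ∷ []) = refl
  hypAt-graph a and (s₁ ∷ s₂ ∷ []) = refl
  hypAt-graph a or (s₁ ∷ s₂ ∷ []) = refl
  hypAt-graph a imp (s₁ ∷ s₂ ∷ []) = refl

  hypotheses : List Formula
  hypotheses = concatMap (λ a → hypothesesAt a (lab φ a) (succ φ a)) (allFin n)

  Hyps-graph : ⋀G (Hyps φ q) ≡ graph (⋀F (map ⊡•F hypotheses))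
  Hyps-graph = begin
    ⋀G (Hyps φ q)
      ≡⟨ cong ⋀G (Listₚ.concatMap-cong (λ a → hypAt-graph a (lab φ a) (succ φ a)) (allFin n)) ⟩
    ⋀G (concatMap (map (graph ∘ ⊡•F) ∘ λ a → hypothesesAt a (lab φ a) (succ φ a)) (allFin n))
      ≡⟨ cong ⋀G (sym (Listₚ.map-concatMap (graph ∘ ⊡•F) _ (allFin n))) ⟩
    ⋀G (map (graph ∘ ⊡•F) hypotheses)
      ≡⟨ cong ⋀G (Listₚ.map-∘ hypotheses) ⟩
    ⋀G (map graph (map ⊡•F hypotheses))
      ≡⟨ ⋀G-graph (map ⊡•F hypotheses) ⟩
    graph (⋀F (map ⊡•F hypotheses)) ∎
    where open ≡-Reasoning

  module Derivation (φ-formula : IsFormula φ) where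

    φ-guarded : Guarded φ
    φ-guarded = formula⇒guarded φ φ-formula

    bounded : ∀ a → BoxWithin φ (suc n) a
    bounded = proj₂ (proj₂ φ-guarded)

    sub : Fin n → Formula
    sub b = formula (Generated.subgraph φ b) (Generated.subgraph-guarded φ b φ-guarded)

    sub-hom : ∀ b → IsHom (graph (sub b)) φ (Generated.vertex φ b)
    sub-hom = Generated.vertex-hom φ

    sub-root : ∀ b → Generated.vertex φ b (root (graph (sub b))) ≡ b
    sub-root = Generated.vertex-root φ

    sub-≃ : ∀ {H π} b → IsHom H φ π → π (root H) ≡ b → H ≃ graph (sub b)
    sub-≃ b hom root↦b = IsHom-≃ {K = φ} hom (sub-hom b) (trans root↦b (sym (sub-root b)))

    leaf-≃ : ∀ {b} A → IsHom (treeG A) φ (λ _ → b) → treeG A ≃ graph (sub b)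
    leaf-≃ {b} A hom = sub-≃ b hom refl

    un-≃ : ∀ u {b s} → lab φ b ≡ ulab u → Pointwise _≡_ (s ∷ []) (succ φ b) →
      unG u (graph (sub s)) ≃ graph (sub b)
    un-≃ u {b} {s} e s≡ =
      sub-≃ b (unG-hom {u} {K = φ} (sub-hom s) (sym e , vec1-MapsTo u (Pw.trans trans (sub-root s ∷ []) s≡)))
        refl

    bin-≃ : ∀ o {b s₁ s₂} → lab φ b ≡ blab o → Pointwise _≡_ (s₁ ∷ s₂ ∷ []) (succ φ b) →
      binG o (graph (sub s₁)) (graph (sub s₂)) ≃ graph (sub b)
    bin-≃ o {b} {s₁} {s₂} e ss≡ = sub-≃ b (binG-hom o _ _ {φ} (sub-hom s₁) (sub-hom s₂) (sym e , roots↦ss)) refl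
      where
      π₁ = Generated.vertex φ s₁
      π₂ = Generated.vertex φ s₂
      roots↦ss : MapsTo (b VF.∷ (π₁ VF.++ π₂)) (succ (binG o (graph (sub s₁)) (graph (sub s₂))) zero) (succ φ b)
      roots↦ss = vec2-MapsTo o (Pw.trans trans
        (trans (VFₚ.lookup-++ˡ π₁ π₂ _) (sub-root s₁) ∷ trans (VFₚ.lookup-++ʳ π₁ π₂ _) (sub-root s₂) ∷ []) ss≡)

    below : ∀ {k b l s m} {cs : Vec (Fin n) m} → BoxWithin φ (suc k) b → lab φ b ≡ l → l ≢ box →
      Pointwise _≡_ cs (succ φ b) → s ∈ᵥ cs → BoxWithin φ k s
    below bounded e l≢□ cs≡ s∈ = BoxWithin-succ φ bounded (l≢□ ∘ trans (sym e)) (Pointwise-∈ cs≡ s∈)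

    Θ Ω M : Formula
    Θ = ⋀F (map ⊡•F hypotheses)
    Ω = ⋀F (map (λ c → ψ (suc n) c ⇔F sub c) (allFin n))
    M = Θ ∧F □F Ω

    Θ-□ : Θ ⊩ □F Θ
    Θ-□ = ⋀-□ (Allₚ.map⁺ (All.universal (λ _ → ⊡•-□) hypotheses))

    M⊩hypothesis : ∀ {b c} → lab φ b ≡ box → Pointwise _≡_ (c ∷ []) (succ φ b) → M ⊩ hypothesis b c
    M⊩hypothesis {b} {c} e c≡ =
      cut (∧-elimˡ assumption) (cut (⋀-elim (∈ₗₚ.∈-map⁺ ⊡•F hyp∈)) (∧-elimˡ assumption))
      where
      hyp∈ : hypothesis b c ∈ₗ hypotheses
      hyp∈ = ∈ₗₚ.∈-concatMap⁺ (λ a → hypothesesAt a (lab φ a) (succ φ a)) (loseₗ (∈ₗₚ.∈-allFin b)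
        (subst (hypothesis b c ∈ₗ_) (node-cong (hypothesesAt b) e c≡) (Any.here refl)))

    M⊩□ψ⇔□sub : ∀ c → M ⊩ □F (ψ (suc n) c) ⇔F □F (sub c)
    M⊩□ψ⇔□sub c = □-cong (cut (∧-elimʳ assumption) (□-mono (⋀-elim (∈ₗₚ.∈-map⁺ _ (∈ₗₚ.∈-allFin c)))))

    M⊩ψ⇔sub : ∀ k b → BoxWithin φ k b → M ⊩ ψ k b ⇔F sub b
    M⊩node⇔sub : ∀ k b → BoxWithin φ (suc k) b → ∀ l cs → lab φ b ≡ l → Pointwise _≡_ cs (succ φ b) →
      M ⊩ treeF (node k b l cs) ⇔F sub b
    M⊩bin⇔sub : ∀ o k b → BoxWithin φ (suc k) b → ∀ s₁ s₂ → lab φ b ≡ blab o →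
      Pointwise _≡_ (s₁ ∷ s₂ ∷ []) (succ φ b) → M ⊩ binF o (ψ k s₁) (ψ k s₂) ⇔F sub b

    M⊩ψ⇔sub (suc k) b bounded = subst (λ A → M ⊩ treeF A ⇔F sub b) (sym (Efuel-node k b))
      (M⊩node⇔sub k b bounded (lab φ b) (succ φ b) refl (Pw.refl refl))

    M⊩node⇔sub k b _ bot [] e cs≡ = weaken (≃⇒⇔ (leaf-≃ ⊥ᶠ λ { zero → sym e , Pointwise-[] cs≡ }))
    M⊩node⇔sub k b _ top [] e cs≡ = weaken (≃⇒⇔ (leaf-≃ ⊤ᶠ λ { zero → sym e , Pointwise-[] cs≡ }))
    M⊩node⇔sub k b _ (var p) [] e cs≡ = weaken (≃⇒⇔ (leaf-≃ (varᶠ p) λ { zero → sym e , Pointwise-[] cs≡ }))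
    M⊩node⇔sub k b bounded neg (s ∷ []) e cs≡ =
      ⇔-trans (¬-cong (M⊩ψ⇔sub k s (below bounded e (λ ()) cs≡ (here refl))))
        (weaken (≃⇒⇔ (un-≃ uneg e cs≡)))
    M⊩node⇔sub k b _ box (c ∷ []) e cs≡ =
      ⇔-trans (M⊩hypothesis e cs≡) (⇔-trans (M⊩□ψ⇔□sub c) (weaken (≃⇒⇔ (un-≃ ubox e cs≡))))
    M⊩node⇔sub k b bounded and (s₁ ∷ s₂ ∷ []) = M⊩bin⇔sub band k b bounded s₁ s₂
    M⊩node⇔sub k b bounded or (s₁ ∷ s₂ ∷ []) = M⊩bin⇔sub bor k b bounded s₁ s₂
    M⊩node⇔sub k b bounded imp (s₁ ∷ s₂ ∷ []) = M⊩bin⇔sub bimp k b bounded s₁ s₂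

    M⊩bin⇔sub o k b bounded s₁ s₂ e ss≡ =
      ⇔-trans (bin-cong o (M⊩ψ⇔sub k s₁ (below bounded e (blab≢box o) ss≡ (here refl)))
                          (M⊩ψ⇔sub k s₂ (below bounded e (blab≢box o) ss≡ (there (here refl)))))
        (weaken (≃⇒⇔ (bin-≃ o e ss≡)))

    M⊩Ω : M ⊩ Ω
    M⊩Ω = ⋀-intro (Allₚ.map⁺ (All.universal (λ c → M⊩ψ⇔sub (suc n) c (bounded c)) (allFin n)))

    Θ⊩Ω : Θ ⊩ Ω
    Θ⊩Ω = ⊢⇒⊩ (löb-rule (⊩⇒⊢ (⇒-intro (cut (∧-intro (∧-elimʳ assumption) □Ω) M⊩Ω))))
      where
      □Ω : □F (Θ ⇒F Ω) ∧F Θ ⊩ □F Ω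
      □Ω = ⇒-elim (cut (∧-elimˡ assumption) K) (cut (∧-elimʳ assumption) Θ-□)

    Θ⊩root : Θ ⊩ ψ (suc n) (root φ) ⇔F formula φ φ-guarded
    Θ⊩root = ⇔-trans (cut Θ⊩M (M⊩ψ⇔sub (suc n) (root φ) (bounded (root φ))))
      (weaken (≃⇒⇔ (IsHom-≃ {K = φ} (sub-hom (root φ)) (IsHom-id φ) (sub-root (root φ)))))
      where
      Θ⊩M : Θ ⊩ M
      Θ⊩M = ∧-intro assumption (cut Θ-□ (□-mono Θ⊩Ω))

theorem3p10 : (φ : Graph) → IsFormula φ →
    (q : Fin (size φ) → ℕ) →
    (∀ a b → IsBoxV φ a → IsBoxV φ b → q a ≡ q b → a ≡ b) →
    (∀ a b → IsBoxV φ b → lab φ a ≢ var (q b)) →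
    Hyps φ q ⊢CHL (treeG (E φ q (root φ)) ⇔G φ)
theorem3p10 φ φ-formula q _ _ =
  subst (λ Γ → ⊢CHL (Γ ⇒G (treeG (E φ q (root φ)) ⇔G φ))) (sym (Hyps-graph φ q))
    (⊩-proof Θ⊩root)
  where open Derivation φ q φ-formula
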